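{- Let $G$ be a finite simple graph that contains no cycle of length $3$ and no cycle of length $4$. Then \[ZC_{1}^{*}(G)=2M_{2}(G)-M_{1}(G).\]
   Context: For a vertex $v$ of a graph $G$, $d_v$ denotes its degree and $\tau_v$ (the connection number of $v$) denotes the number of vertices at distance exactly $2$ from $v$. The modified first Zagreb connection index is $ZC_{1}^{*}(G)=\sum_{v\in V(G)}d_{v}\tau_{v}$. The first Zagreb index is $M_{1}(G)=\sum_{v\in V(G)}d_{v}^{2}$ and the second Zagreb index is $M_{2}(G)=\sum_{uv\in E(G)}d_{u}d_{v}$. -}

module Defs where

open import Data.Nat using (ℕ; zero; suc; _+_; _*_; _<_)
import Data.Nat
open import Data.Bool using (Bool; true; false; if_then_else_; _∧_; not; T)
open import Data.Fin using (Fin; zero; suc; toℕ; _≟_)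
open import Data.Product using (_×_)
open import Relation.Nullary using (¬_)
open import Relation.Nullary.Decidable using (⌊_⌋)
open import Relation.Binary.PropositionalEquality using (_≡_; _≢_)

Σ : {n : ℕ} → (Fin n → ℕ) → ℕ
Σ {zero}  f = 0
Σ {suc n} f = f zero + Σ (λ i → f (suc i))

anyF : {n : ℕ} → (Fin n → Bool) → Bool
anyF {zero}  f = false
anyF {suc n} f = if f zero then true else anyF (λ i → f (suc i))

record SimpleGraph (n : ℕ) : Set where
  field
    adj   : Fin n → Fin n → Bool
    sym   : ∀ u v → adj u v ≡ adj v u
    irrfl : ∀ v → adj v v ≡ false

open SimpleGraph public

module _ {n : ℕ} (G : SimpleGraph n) where

  Adj : Fin n → Fin n → Set
  Adj u v = T (adj G u v)

  deg : Fin n → ℕ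
  deg v = Σ (λ w → if adj G v w then 1 else 0)

  dist2 : Fin n → Fin n → Bool
  dist2 v w = not ⌊ v ≟ w ⌋ ∧ not (adj G v w) ∧ anyF (λ u → adj G v u ∧ adj G u w)

  τ : Fin n → ℕ
  τ v = Σ (λ w → if dist2 v w then 1 else 0)

  ZC1* : ℕ
  ZC1* = Σ (λ v → deg v * τ v)

  M1 : ℕ
  M1 = Σ (λ v → deg v * deg v)

  M2 : ℕ
  M2 = Σ (λ u → Σ (λ v → if adj G u v ∧ ⌊ toℕ u Data.Nat.<? toℕ v ⌋ then deg u * deg v else 0))

  NoC3 : Set
  NoC3 = ∀ a b c → a ≢ b → b ≢ c → a ≢ c → ¬ (Adj a b × Adj b c × Adj c a)

  -- G contains no cycle of length 4 (as a subgraph, not necessarily induced)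
  NoC4 : Set
  NoC4 = ∀ a b c d → a ≢ b → a ≢ c → a ≢ d → b ≢ c → b ≢ d → c ≢ d →
         ¬ (Adj a b × Adj b c × Adj c d × Adj d a)

module Submission where

-- Write W(v,w) = #{u | v ~ u ~ w} for the number of walks of
-- length 2 from v to w.  Counting pairs (u,w) with v ~ u ~ w in two ways,
--     Σ_{u ~ v} d_u  =  Σ_w W(v,w)  =  W(v,v) + Σ_{w ≠ v} W(v,w),
-- and W(v,v) = d_v in every graph.  If G has no triangle, then W(v,w) = 0
-- whenever v ~ w; if G has no 4-cycle, two distinct vertices have at most
-- one common neighbour.  Hence for w ≠ v, W(v,w) is exactly the indicator
-- of "w is at distance 2 from v", and Σ_{u ~ v} d_u = d_v + τ_v.
-- On the other hand, in every graph Σ_v d_v · Σ_{u ~ v} d_u = 2 M₂, since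
-- each edge uv contributes d_u d_v once from each endpoint.  Multiplying
-- the first identity by d_v and summing gives ZC₁* + M₁ = 2 M₂ over ℕ, and
-- the theorem is the same identity read in ℤ.

open import Defs
open import Data.Nat using (ℕ; zero; suc; _+_; _*_; _∸_; _<?_)
open import Data.Nat.Properties
  using (+-comm; *-comm; *-distribˡ-+; *-zeroʳ; +-identityʳ; <-asym; ≮⇒≥; ≤-antisym; m≤n+m; m+n∸n≡m)
open import Data.Nat.Tactic.RingSolver using (solve-∀)
open import Data.Integer using (+_; _-_; _⊖_)
open import Data.Integer.Properties using ([+m]-[+n]≡m⊖n; ⊖-≥)
open import Data.Bool using (Bool; true; false; if_then_else_; _∧_; not; T)
open import Data.Bool.Properties using (∧-idem)
open import Data.Unit using (tt)
open import Data.Empty using (⊥-elim)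
open import Data.Fin using (Fin; zero; suc; toℕ; _≟_)
open import Data.Fin.Properties using (toℕ-injective; suc-injective)
open import Data.Product using (_,_; _×_)
open import Relation.Nullary using (yes; no)
open import Relation.Nullary.Decidable using (⌊_⌋)
open import Relation.Binary.PropositionalEquality
  using (_≡_; _≢_; refl; cong; cong₂; subst; trans; module ≡-Reasoning)
  renaming (sym to ≡-sym)

Σ-cong : ∀ {n} {f g : Fin n → ℕ} → (∀ i → f i ≡ g i) → Σ f ≡ Σ g
Σ-cong {zero}  eq = refl
Σ-cong {suc n} eq = cong₂ _+_ (eq zero) (Σ-cong (λ i → eq (suc i)))

Σ-zero : ∀ {n} (f : Fin n → ℕ) → (∀ i → f i ≡ 0) → Σ f ≡ 0
Σ-zero {zero}  f eq = refl
Σ-zero {suc n} f eq rewrite eq zero = Σ-zero (λ i → f (suc i)) (λ i → eq (suc i))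

Σ-+ : ∀ {n} (f g : Fin n → ℕ) → Σ (λ i → f i + g i) ≡ Σ f + Σ g
Σ-+ {zero}  f g = refl
Σ-+ {suc n} f g =
  trans (cong (_+_ (f zero + g zero)) (Σ-+ (λ i → f (suc i)) (λ i → g (suc i))))
        (interchange (f zero) (g zero) _ _)
  where
  interchange : ∀ a b c d → (a + b) + (c + d) ≡ (a + c) + (b + d)
  interchange = solve-∀

Σ-*ˡ : ∀ {n} c (f : Fin n → ℕ) → c * Σ f ≡ Σ (λ i → c * f i)
Σ-*ˡ {zero}  c f = *-zeroʳ c
Σ-*ˡ {suc n} c f =
  trans (*-distribˡ-+ c (f zero) _) (cong (_+_ (c * f zero)) (Σ-*ˡ c (λ i → f (suc i))))

Σ-swap : ∀ {m n} (f : Fin m → Fin n → ℕ) →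
         Σ (λ i → Σ (λ j → f i j)) ≡ Σ (λ j → Σ (λ i → f i j))
Σ-swap {zero}  {n} f = ≡-sym (Σ-zero {n} _ (λ _ → refl))
Σ-swap {suc m}     f =
  trans (cong (_+_ (Σ (f zero))) (Σ-swap (λ i → f (suc i))))
        (≡-sym (Σ-+ (f zero) (λ j → Σ (λ i → f (suc i) j))))

Σ-single : ∀ {n} (f : Fin n → ℕ) (v : Fin n) → (∀ w → w ≢ v → f w ≡ 0) → Σ f ≡ f v
Σ-single {suc n} f zero    eq =
  trans (cong (_+_ (f zero)) (Σ-zero _ (λ i → eq (suc i) (λ ())))) (+-identityʳ _)
Σ-single {suc n} f (suc v) eq rewrite eq zero (λ ()) =
  Σ-single (λ i → f (suc i)) v (λ w w≢v → eq (suc w) (λ e → w≢v (suc-injective e)))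

ind : Bool → ℕ
ind b = if b then 1 else 0

Σ-ind-unique : ∀ {n} (b : Fin n → Bool) → (∀ i j → T (b i) → T (b j) → i ≡ j) →
               Σ (λ i → ind (b i)) ≡ ind (anyF b)
Σ-ind-unique {zero}  b unique = refl
Σ-ind-unique {suc n} b unique with b zero in b0
... | true  = cong suc (Σ-zero _ rest-false)
  where
  rest-false : ∀ i → ind (b (suc i)) ≡ 0
  rest-false i with b (suc i) in bi
  ... | false = refl
  ... | true with unique zero (suc i) (subst T (≡-sym b0) tt) (subst T (≡-sym bi) tt)
  ...          | ()
... | false = Σ-ind-unique (λ i → b (suc i))
                (λ i j ti tj → suc-injective (unique (suc i) (suc j) ti tj))

*-if : ∀ c (b : Bool) x → c * (if b then x else 0) ≡ (if b then c * x else 0)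
*-if c true  x = refl
*-if c false x = *-zeroʳ c

T-≡ : ∀ {b} → b ≡ true → T b
T-≡ refl = tt

T-∧ : ∀ a b → T (a ∧ b) → T a × T b
T-∧ true true t = tt , tt

module AnyGraph {n : ℕ} (G : SimpleGraph n) where

  Adj-sym : ∀ {u v} → Adj G u v → Adj G v u
  Adj-sym {u} {v} = subst T (SimpleGraph.sym G u v)

  Adj⇒≢ : ∀ {u v} → Adj G u v → u ≢ v
  Adj⇒≢ {u} uv refl = subst T (irrfl G u) uv

  walks₂ : Fin n → Fin n → ℕ
  walks₂ v w = Σ (λ u → ind (adj G v u ∧ adj G u w))

  neighbourDegSum : Fin n → ℕ
  neighbourDegSum v = Σ (λ u → if adj G v u then deg G u else 0)

  -- Each neighbour u of v is the middle vertex of d_u walks of length 2.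
  neighbourDegSum≡Σwalks₂ : ∀ v → neighbourDegSum v ≡ Σ (walks₂ v)
  neighbourDegSum≡Σwalks₂ v =
    trans (Σ-cong middle) (Σ-swap (λ u w → ind (adj G v u ∧ adj G u w)))
    where
    middle : ∀ u → (if adj G v u then deg G u else 0) ≡ Σ (λ w → ind (adj G v u ∧ adj G u w))
    middle u with adj G v u
    ... | true  = refl
    ... | false = ≡-sym (Σ-zero {n} _ (λ _ → refl))

  walks₂-diag : ∀ v → walks₂ v v ≡ deg G v
  walks₂-diag v = Σ-cong (λ u →
    cong ind (trans (cong (adj G v u ∧_) (SimpleGraph.sym G u v)) (∧-idem _)))

  halfEdge : Fin n → Fin n → ℕ
  halfEdge u v = if adj G u v ∧ ⌊ toℕ u <? toℕ v ⌋ then deg G u * deg G v else 0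

  edgeTerm-split : ∀ u v → (if adj G u v then deg G u * deg G v else 0) ≡ halfEdge u v + halfEdge v u
  edgeTerm-split u v rewrite SimpleGraph.sym G v u with adj G u v in uv
  ... | false = refl
  ... | true with toℕ u <? toℕ v | toℕ v <? toℕ u
  ...   | yes u<v | yes v<u = ⊥-elim (<-asym u<v v<u)
  ...   | yes u<v | no  v≮u = ≡-sym (+-identityʳ _)
  ...   | no  u≮v | yes v<u = *-comm (deg G u) (deg G v)
  ...   | no  u≮v | no  v≮u =
    ⊥-elim (Adj⇒≢ (T-≡ uv) (toℕ-injective (≤-antisym (≮⇒≥ v≮u) (≮⇒≥ u≮v))))

  -- Σ_v d_v Σ_{u ~ v} d_u = 2 M₂: every edge is seen from both endpoints.
  Σdeg*neighbourDegSum≡2M2 : Σ (λ v → deg G v * neighbourDegSum v) ≡ 2 * M2 G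
  Σdeg*neighbourDegSum≡2M2 = begin
      Σ (λ v → deg G v * neighbourDegSum v)
    ≡⟨ Σ-cong (λ v → Σ-*ˡ (deg G v) (λ u → if adj G v u then deg G u else 0)) ⟩
      Σ (λ v → Σ (λ u → deg G v * (if adj G v u then deg G u else 0)))
    ≡⟨ Σ-cong (λ v → Σ-cong (λ u → trans (*-if (deg G v) (adj G v u) (deg G u)) (edgeTerm-split v u))) ⟩
      Σ (λ v → Σ (λ u → halfEdge v u + halfEdge u v))
    ≡⟨ Σ-cong (λ v → Σ-+ (halfEdge v) (λ u → halfEdge u v)) ⟩
      Σ (λ v → Σ (halfEdge v) + Σ (λ u → halfEdge u v))
    ≡⟨ Σ-+ (λ v → Σ (halfEdge v)) (λ v → Σ (λ u → halfEdge u v)) ⟩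
      M2 G + Σ (λ v → Σ (λ u → halfEdge u v))
    ≡⟨ cong (_+_ (M2 G)) (≡-sym (Σ-swap halfEdge)) ⟩
      M2 G + M2 G
    ≡⟨ cong (_+_ (M2 G)) (≡-sym (+-identityʳ _)) ⟩
      2 * M2 G ∎
    where open ≡-Reasoning

module Girth5 {n : ℕ} (G : SimpleGraph n) (noC3 : NoC3 G) (noC4 : NoC4 G) where
  open AnyGraph G

  -- Without triangles adjacent vertices have no common neighbour, and
  -- without 4-cycles distinct vertices have at most one.
  walks₂-offdiag : ∀ v w → v ≢ w →
                   walks₂ v w ≡ ind (not (adj G v w) ∧ anyF (λ u → adj G v u ∧ adj G u w))
  walks₂-offdiag v w v≢w with adj G v w in vw
  ... | true  = Σ-zero _ noCommon
    where
    noCommon : ∀ u → ind (adj G v u ∧ adj G u w) ≡ 0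
    noCommon u with adj G v u in vu | adj G u w in uw
    ... | true  | true  = ⊥-elim (noC3 v u w (Adj⇒≢ (T-≡ vu)) (Adj⇒≢ (T-≡ uw)) v≢w
                                    (T-≡ vu , T-≡ uw , Adj-sym (T-≡ vw)))
    ... | true  | false = refl
    ... | false | _     = refl
  ... | false = Σ-ind-unique _ commonUnique
    where
    commonUnique : ∀ i j → T (adj G v i ∧ adj G i w) → T (adj G v j ∧ adj G j w) → i ≡ j
    commonUnique i j viw vjw with i ≟ j | T-∧ (adj G v i) _ viw | T-∧ (adj G v j) _ vjw
    ... | yes i≡j | _          | _          = i≡j
    ... | no  i≢j | vi , iw    | vj , jw    =
      ⊥-elim (noC4 v i w j (Adj⇒≢ vi) v≢w (Adj⇒≢ vj) (Adj⇒≢ iw) i≢j (λ w≡j → Adj⇒≢ jw (≡-sym w≡j))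
                   (vi , iw , Adj-sym jw , Adj-sym vj))

  walks₂-decomp : ∀ v w → walks₂ v w ≡ (if ⌊ v ≟ w ⌋ then deg G v else 0) + ind (dist2 G v w)
  walks₂-decomp v w with v ≟ w
  ... | yes refl = trans (walks₂-diag v) (≡-sym (+-identityʳ _))
  ... | no  v≢w  = walks₂-offdiag v w v≢w

  neighbourDegSum≡deg+τ : ∀ v → neighbourDegSum v ≡ deg G v + τ G v
  neighbourDegSum≡deg+τ v = begin
      neighbourDegSum v
    ≡⟨ neighbourDegSum≡Σwalks₂ v ⟩
      Σ (walks₂ v)
    ≡⟨ Σ-cong (walks₂-decomp v) ⟩
      Σ (λ w → diagonal w + ind (dist2 G v w))
    ≡⟨ Σ-+ diagonal (λ w → ind (dist2 G v w)) ⟩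
      Σ diagonal + τ G v
    ≡⟨ cong (λ x → x + τ G v) (trans (Σ-single diagonal v offDiagonal) onDiagonal) ⟩
      deg G v + τ G v ∎
    where
    open ≡-Reasoning
    diagonal : Fin n → ℕ
    diagonal w = if ⌊ v ≟ w ⌋ then deg G v else 0
    offDiagonal : ∀ w → w ≢ v → diagonal w ≡ 0
    offDiagonal w w≢v with v ≟ w
    ... | yes v≡w = ⊥-elim (w≢v (≡-sym v≡w))
    ... | no  _   = refl
    onDiagonal : diagonal v ≡ deg G v
    onDiagonal with v ≟ v
    ... | yes _   = refl
    ... | no  v≢v = ⊥-elim (v≢v refl)

  ZC1*+M1≡2M2 : ZC1* G + M1 G ≡ 2 * M2 G
  ZC1*+M1≡2M2 = begin
      ZC1* G + M1 G
    ≡⟨ ≡-sym (Σ-+ (λ v → deg G v * τ G v) (λ v → deg G v * deg G v)) ⟩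
      Σ (λ v → deg G v * τ G v + deg G v * deg G v)
    ≡⟨ Σ-cong (λ v → ≡-sym (*-distribˡ-+ (deg G v) (τ G v) (deg G v))) ⟩
      Σ (λ v → deg G v * (τ G v + deg G v))
    ≡⟨ Σ-cong (λ v → cong (deg G v *_) (trans (+-comm (τ G v) (deg G v)) (≡-sym (neighbourDegSum≡deg+τ v)))) ⟩
      Σ (λ v → deg G v * neighbourDegSum v)
    ≡⟨ Σdeg*neighbourDegSum≡2M2 ⟩
      2 * M2 G ∎
    where open ≡-Reasoning

+-⇒-ℤ : ∀ a b c → a + b ≡ c → + a ≡ + c - + b
+-⇒-ℤ a b c refl = ≡-sym (begin
    + (a + b) - + b  ≡⟨ [+m]-[+n]≡m⊖n (a + b) b ⟩
    (a + b) ⊖ b      ≡⟨ ⊖-≥ (m≤n+m b a) ⟩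
    + (a + b ∸ b)    ≡⟨ cong +_ (m+n∸n≡m a b) ⟩
    + a              ∎)
  where open ≡-Reasoning

corollary2p2 : (n : ℕ) (G : SimpleGraph n) → NoC3 G → NoC4 G →
    + ZC1* G ≡ (+ (2 Data.Nat.* M2 G)) - (+ M1 G)
corollary2p2 n G noC3 noC4 = +-⇒-ℤ (ZC1* G) (M1 G) (2 * M2 G) (Girth5.ZC1*+M1≡2M2 G noC3 noC4)
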